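{- For all integers $s\geq 2$ and $n\geq 2$, $M_s(n+1)\leq M_s(n)+2$.
   Context: For integers $c,s\geq 1$, $K_{c\times s}$ denotes the complete multipartite graph with $c$ classes of $s$ vertices each. For a subgraph $H$ of $K_{c\times s}$, $\overline{H}$ denotes the complement of $H$ relative to $K_{c\times s}$. $C_4$ is the $4$-cycle and $K_{1,n}$ is the star with $n+1$ vertices. $M_s(n)$ is the smallest positive integer $c$ such that for every subgraph $H$ of $K_{c\times s}$, $H$ contains a copy of $C_4$ or $\overline{H}$ contains a copy of $K_{1,n}$. -}

module Defs where

open import Data.Nat using (ℕ; _≤_)
open import Data.Fin using (Fin)
open import Data.Bool using (Bool; true; false)
open import Data.Product using (Σ; _×_; proj₁)
open import Data.Sum using (_⊎_)
open import Relation.Binary.PropositionalEquality using (_≡_; _≢_)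
open import Function.Definitions using (Injective)

-- Vertices of K_{c×s}: class index (Fin c) and position within the class (Fin s).
Vertex : ℕ → ℕ → Set
Vertex c s = Fin c × Fin s

KEdge : {c s : ℕ} → Vertex c s → Vertex c s → Set
KEdge u v = proj₁ u ≢ proj₁ v

record Subgraph (c s : ℕ) : Set where
  field
    adj    : Vertex c s → Vertex c s → Bool
    adj-sym : ∀ u v → adj u v ≡ adj v u
    adj-K  : ∀ u v → adj u v ≡ true → KEdge u v
open Subgraph public

HEdge : {c s : ℕ} → Subgraph c s → Vertex c s → Vertex c s → Set
HEdge H u v = adj H u v ≡ true

CoEdge : {c s : ℕ} → Subgraph c s → Vertex c s → Vertex c s → Set
CoEdge H u v = KEdge u v × adj H u v ≡ false

HasC4 : {c s : ℕ} → Subgraph c s → Set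
HasC4 {c} {s} H =
  Σ (Vertex c s) λ a → Σ (Vertex c s) λ b → Σ (Vertex c s) λ d → Σ (Vertex c s) λ e →
    (a ≢ b × a ≢ d × a ≢ e × b ≢ d × b ≢ e × d ≢ e) ×
    (HEdge H a b × HEdge H b d × HEdge H d e × HEdge H e a)

CoHasStar : {c s : ℕ} → Subgraph c s → ℕ → Set
CoHasStar {c} {s} H n =
  Σ (Vertex c s) λ v → Σ (Fin n → Vertex c s) λ f →
    Injective _≡_ _≡_ f × (∀ i → CoEdge H v (f i))

Arrows : ℕ → ℕ → ℕ → Set
Arrows s n c = (H : Subgraph c s) → HasC4 H ⊎ CoHasStar H n

-- m is M_s(n): the smallest positive integer c with Arrows s n c.
IsM : ℕ → ℕ → ℕ → Set
IsM s n m = 1 ≤ m × Arrows s n m × (∀ c → 1 ≤ c → Arrows s n c → m ≤ c)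

module Submission where

-- Let H ⊆ K_{(m+2)×s} and let y₀ ≠ y₁ be two vertices of one class L (this needs s ≥ 2).
-- Restricted to m classes other than L, H contains C₄ or its complement contains a star
-- K_{1,n} centred at v.  If v is not H-adjacent to y₀ (or y₁), that vertex is one more
-- leaf, giving K_{1,n+1}.  Otherwise v is a common neighbour of y₀ and y₁; repeating the
-- argument on m classes avoiding L and the class of v yields a second common neighbour w,
-- and v y₀ w y₁ is a C₄.  The least class count with this arrowing property exists
-- because the property is decidable: subgraphs of K_{c×s} are searched exhaustively, up
-- to pointwise equality of their adjacency functions.

open import Defs
open import Data.Bool using (Bool; true; false)
open import Data.Bool.Properties using () renaming (_≟_ to _≟ᵇ_)
open import Data.Empty using (⊥-elim)
open import Data.Fin using (Fin; zero; suc; punchIn; finToFun; funToFin)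
open import Data.Fin.Properties
  using (any?; all?; *↔×; 2↔Bool; 0≢1+n; suc-injective; punchIn-injective; punchInᵢ≢i; finToFun-funToFin)
  renaming (_≟_ to _≟ᶠ_)
open import Data.Nat using (ℕ; zero; suc; _+_; _^_; _≤_; _<_; z≤n; s≤s)
open import Data.Nat.Properties using (≤-refl; ≤-trans; ≤-reflexive; ≮⇒≥; +-comm; m<1+n⇒m<n∨m≡n; _≤?_)
open import Data.Product using (Σ; ∃; _×_; _,_; proj₁; proj₂; map₁)
open import Data.Product.Properties using (≡-dec)
open import Data.Product.Function.NonDependent.Propositional using (_×-↔_)
open import Data.Sum using (_⊎_; inj₁; inj₂; [_,_]′)
import Data.Sum as Sum
open import Data.Vec.Functional using (_∷_)
open import Function using (_∘_; _↔_; Inverse)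
open import Function.Definitions using (Injective)
open import Function.Properties.Inverse using (↔-refl; ↔-trans)
open import Relation.Binary.Definitions using (DecidableEquality)
open import Relation.Binary.PropositionalEquality using (_≡_; _≢_; _≗_; refl; sym; trans; cong; subst; module ≡-Reasoning)
open import Relation.Nullary using (Dec; yes; no; ¬_)
open import Relation.Nullary.Decidable using (map′; _×-dec_; _⊎-dec_; _→-dec_; ¬?)
open import Relation.Unary using (Decidable)

module _ {k : ℕ} {A : Set} (α : Fin k ↔ A) where
  open Inverse α

  any-↔? : {P : A → Set} → Decidable P → Dec (∃ P)
  any-↔? {P} P? = map′ (λ (i , p) → to i , p)
    (λ (x , p) → from x , subst P (sym (strictlyInverseˡ x)) p)
    (any? (P? ∘ to))

  all-↔? : {P : A → Set} → Decidable P → Dec (∀ x → P x)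
  all-↔? {P} P? = map′ (λ h x → subst P (strictlyInverseˡ x) (h (from x))) (λ h → h ∘ to)
    (all? (P? ∘ to))

module _ {k l : ℕ} {A B : Set} (α : Fin k ↔ A) (β : Fin l ↔ B) where
  private
    module α = Inverse α
    module β = Inverse β

  decodeFun : Fin (l ^ k) → A → B
  decodeFun code = β.to ∘ finToFun code ∘ α.from

  encodeFun : (A → B) → Fin (l ^ k)
  encodeFun h = funToFin (β.from ∘ h ∘ α.to)

  decodeFun-encodeFun : ∀ h → decodeFun (encodeFun h) ≗ h
  decodeFun-encodeFun h x = begin
    β.to (finToFun (encodeFun h) (α.from x)) ≡⟨ cong β.to (finToFun-funToFin _ (α.from x)) ⟩
    β.to (β.from (h (α.to (α.from x))))      ≡⟨ β.strictlyInverseˡ _ ⟩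
    h (α.to (α.from x))                      ≡⟨ cong h (α.strictlyInverseˡ x) ⟩
    h x                                      ∎
    where open ≡-Reasoning

  module _ {P : (A → B) → Set} (P-resp : ∀ {f g} → f ≗ g → P f → P g) (P? : Decidable P) where

    any-fun? : Dec (∃ P)
    any-fun? = map′ (λ (code , p) → decodeFun code , p)
      (λ (h , p) → encodeFun h , P-resp (sym ∘ decodeFun-encodeFun h) p)
      (any? (P? ∘ decodeFun))

    all-fun? : Dec (∀ h → P h)
    all-fun? = map′ (λ all h → P-resp (decodeFun-encodeFun h) (all (encodeFun h))) (λ all → all ∘ decodeFun)
      (all? (P? ∘ decodeFun))

injective? : ∀ {n} {A : Set} → DecidableEquality A → (f : Fin n → A) → Dec (Injective _≡_ _≡_ f)
injective? _≟_ f = map′ (λ h {i} {j} → h i j) (λ f-inj _ _ → f-inj)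
  (all? λ i → all? λ j → (f i ≟ f j) →-dec (i ≟ᶠ j))

∷-injective : ∀ {n} {A : Set} {x : A} {f : Fin n → A} →
              Injective _≡_ _≡_ f → (∀ i → f i ≢ x) → Injective _≡_ _≡_ (x ∷ f)
∷-injective f-inj f≢x {zero}  {zero}  _  = refl
∷-injective f-inj f≢x {zero}  {suc j} eq = ⊥-elim (f≢x j (sym eq))
∷-injective f-inj f≢x {suc i} {zero}  eq = ⊥-elim (f≢x i eq)
∷-injective f-inj f≢x {suc i} {suc j} eq = cong suc (f-inj eq)

Least : (ℕ → Set) → ℕ → Set
Least P m = P m × (∀ k → P k → m ≤ k)

module _ {P : ℕ → Set} (P? : Decidable P) where

  least-or-none-below : ∀ n → (∃ (Least P)) ⊎ (∀ k → k < n → ¬ P k)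
  least-or-none-below zero = inj₂ λ _ ()
  least-or-none-below (suc n) with least-or-none-below n
  ... | inj₁ found = inj₁ found
  ... | inj₂ none with P? n
  ...   | yes p  = inj₁ (n , p , λ k pk → ≮⇒≥ λ k<n → none k k<n pk)
  ...   | no ¬p = inj₂ λ k k<1+n → [ none k , (λ { refl → ¬p }) ]′ (m<1+n⇒m<n∨m≡n k<1+n)

  least : ∀ {n} → P n → ∃ (Least P)
  least {n} p with least-or-none-below (suc n)
  ... | inj₁ found = found
  ... | inj₂ none  = ⊥-elim (none n ≤-refl p)

IsCoStar : ∀ {c s n} → Subgraph c s → Vertex c s → (Fin n → Vertex c s) → Set
IsCoStar H v f = Injective _≡_ _≡_ f × (∀ i → CoEdge H v (f i))

module _ {c s : ℕ} (H : Subgraph c s) where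

  HEdge⇒≢ : ∀ {u v} → HEdge H u v → u ≢ v
  HEdge⇒≢ {u} {v} uv u≡v = adj-K H u v uv (cong proj₁ u≡v)

  common-neighbours⇒HasC4 : ∀ {v w y₀ y₁} → v ≢ w → y₀ ≢ y₁ →
                            HEdge H v y₀ → HEdge H v y₁ → HEdge H w y₀ → HEdge H w y₁ → HasC4 H
  common-neighbours⇒HasC4 {v} {w} {y₀} {y₁} v≢w y₀≢y₁ vy₀ vy₁ wy₀ wy₁ =
    v , y₀ , w , y₁ ,
    (HEdge⇒≢ vy₀ , v≢w , HEdge⇒≢ vy₁ , HEdge⇒≢ wy₀ ∘ sym , y₀≢y₁ , HEdge⇒≢ wy₁) ,
    (vy₀ , trans (adj-sym H y₀ w) wy₀ , wy₁ , trans (adj-sym H y₁ v) vy₁)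

  extend-or-adjacent : ∀ {n v} {f : Fin n → Vertex c s} → IsCoStar H v f →
                       ∀ y → (∀ i → proj₁ (f i) ≢ proj₁ y) → proj₁ v ≢ proj₁ y →
                       CoHasStar H (suc n) ⊎ HEdge H v y
  extend-or-adjacent {v = v} {f} (f-inj , co) y f≁y v≁y with adj H v y in vy
  ... | true  = inj₂ refl
  ... | false = inj₁ (v , y ∷ f , ∷-injective f-inj (λ i → f≁y i ∘ cong proj₁) ,
                      λ { zero → v≁y , vy ; (suc i) → co i })

module _ {m M s : ℕ} (g : Fin m → Fin M) where

  liftᵥ : Vertex m s → Vertex M s
  liftᵥ = map₁ g

  restrict : Subgraph M s → Subgraph m s
  restrict H = record
    { adj     = λ u v → adj H (liftᵥ u) (liftᵥ v)
    ; adj-sym = λ u v → adj-sym H (liftᵥ u) (liftᵥ v)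
    ; adj-K   = λ u v uv → adj-K H (liftᵥ u) (liftᵥ v) uv ∘ cong g
    }

  module _ (g-inj : Injective _≡_ _≡_ g) where

    liftᵥ-injective : Injective _≡_ _≡_ liftᵥ
    liftᵥ-injective {i , p} {j , q} eq with g-inj (cong proj₁ eq) | cong proj₂ eq
    ... | refl | refl = refl

    module _ (H : Subgraph M s) where

      HasC4-restrict : HasC4 (restrict H) → HasC4 H
      HasC4-restrict (a , b , d , e , (n₁ , n₂ , n₃ , n₄ , n₅ , n₆) , cycle) =
        liftᵥ a , liftᵥ b , liftᵥ d , liftᵥ e ,
        (n₁ ∘ liftᵥ-injective , n₂ ∘ liftᵥ-injective , n₃ ∘ liftᵥ-injective ,
         n₄ ∘ liftᵥ-injective , n₅ ∘ liftᵥ-injective , n₆ ∘ liftᵥ-injective) ,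
        cycle

      IsCoStar-restrict : ∀ {n v} {f : Fin n → Vertex m s} →
                          IsCoStar (restrict H) v f → IsCoStar H (liftᵥ v) (liftᵥ ∘ f)
      IsCoStar-restrict (f-inj , co) = f-inj ∘ liftᵥ-injective , λ i → proj₁ (co i) ∘ g-inj , proj₂ (co i)

module _ {s′ n m : ℕ} (arr : Arrows (2 + s′) n m) (H : Subgraph (2 + m) (2 + s′)) where

  avoiding : Fin (suc m) → Fin m → Fin (2 + m)
  avoiding k = suc ∘ punchIn k

  avoiding-injective : ∀ k → Injective _≡_ _≡_ (avoiding k)
  avoiding-injective k eq = punchIn-injective k _ _ (suc-injective eq)

  y₀ y₁ : Vertex (2 + m) (2 + s′)
  y₀ = zero , zero
  y₁ = zero , suc zero

  CommonNeighbourOutside : Fin (suc m) → Set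
  CommonNeighbourOutside k =
    Σ (Fin (suc m)) λ k′ → Σ (Fin (2 + s′)) λ p →
      k′ ≢ k × HEdge H (suc k′ , p) y₀ × HEdge H (suc k′ , p) y₁

  common-neighbour-outside : ∀ k → (HasC4 H ⊎ CoHasStar H (suc n)) ⊎ CommonNeighbourOutside k
  common-neighbour-outside k with arr (restrict (avoiding k) H)
  ... | inj₁ c₄ = inj₁ (inj₁ (HasC4-restrict (avoiding k) (avoiding-injective k) H c₄))
  ... | inj₂ ((j , p) , f , star)
    with extend-or-adjacent H star′ y₀ (λ _ → 0≢1+n ∘ sym) (0≢1+n ∘ sym)
       | extend-or-adjacent H star′ y₁ (λ _ → 0≢1+n ∘ sym) (0≢1+n ∘ sym)
    where star′ = IsCoStar-restrict (avoiding k) (avoiding-injective k) H star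
  ... | inj₁ bigger | _            = inj₁ (inj₂ bigger)
  ... | inj₂ _      | inj₁ bigger  = inj₁ (inj₂ bigger)
  ... | inj₂ vy₀    | inj₂ vy₁     = inj₂ (punchIn k j , p , punchInᵢ≢i k j , vy₀ , vy₁)

  HasC4-or-CoHasStar-suc : HasC4 H ⊎ CoHasStar H (suc n)
  HasC4-or-CoHasStar-suc with common-neighbour-outside zero
  ... | inj₁ done = done
  ... | inj₂ (k , p , _ , vy₀ , vy₁) with common-neighbour-outside k
  ...   | inj₁ done = done
  ...   | inj₂ (k′ , q , k′≢k , wy₀ , wy₁) =
    inj₁ (common-neighbours⇒HasC4 H (k′≢k ∘ sym ∘ suc-injective ∘ cong proj₁) (0≢1+n ∘ cong proj₂)
                                   vy₀ vy₁ wy₀ wy₁)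

Arrows-suc : ∀ {s′ n m} → Arrows (2 + s′) n m → Arrows (2 + s′) (suc n) (2 + m)
Arrows-suc = HasC4-or-CoHasStar-suc

module _ {c s : ℕ} where

  any-vertex? : {P : Vertex c s → Set} → Decidable P → Dec (∃ P)
  any-vertex? = any-↔? *↔×

  all-vertex? : {P : Vertex c s → Set} → Decidable P → Dec (∀ v → P v)
  all-vertex? = all-↔? *↔×

  _≟ᵥ_ : DecidableEquality (Vertex c s)
  _≟ᵥ_ = ≡-dec (_≟ᶠ_ {c}) (_≟ᶠ_ {s})

  module _ {H H′ : Subgraph c s} (same : ∀ u v → adj H u v ≡ adj H′ u v) where

    HasC4-resp : HasC4 H → HasC4 H′
    HasC4-resp (a , b , d , e , distinct , (ab , bd , de , ea)) =
      a , b , d , e , distinct ,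
      (trans (sym (same a b)) ab , trans (sym (same b d)) bd , trans (sym (same d e)) de , trans (sym (same e a)) ea)

    CoHasStar-resp : ∀ {n} → CoHasStar H n → CoHasStar H′ n
    CoHasStar-resp (v , f , f-inj , co) = v , f , f-inj , λ i → proj₁ (co i) , trans (sym (same v (f i))) (proj₂ (co i))

  module _ (H : Subgraph c s) where

    HasC4? : Dec (HasC4 H)
    HasC4? = any-vertex? λ a → any-vertex? λ b → any-vertex? λ d → any-vertex? λ e →
      (¬? (a ≟ᵥ b) ×-dec ¬? (a ≟ᵥ d) ×-dec ¬? (a ≟ᵥ e) ×-dec ¬? (b ≟ᵥ d) ×-dec ¬? (b ≟ᵥ e) ×-dec ¬? (d ≟ᵥ e))
      ×-dec (adj H a b ≟ᵇ true ×-dec adj H b d ≟ᵇ true ×-dec adj H d e ≟ᵇ true ×-dec adj H e a ≟ᵇ true)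

    IsCoStar-resp : ∀ {n v} {f g : Fin n → Vertex c s} → f ≗ g → IsCoStar H v f → IsCoStar H v g
    IsCoStar-resp {v = v} f≗g (f-inj , co) =
      (λ eq → f-inj (trans (f≗g _) (trans eq (sym (f≗g _))))) , λ i → subst (CoEdge H v) (f≗g i) (co i)

    CoHasStar? : ∀ n → Dec (CoHasStar H n)
    CoHasStar? n = any-vertex? λ v → any-fun? ↔-refl *↔× (IsCoStar-resp {v = v}) λ f →
      injective? _≟ᵥ_ f ×-dec all? λ i → ¬? (proj₁ v ≟ᶠ proj₁ (f i)) ×-dec adj H v (f i) ≟ᵇ false

  -- Adjacency relations uncurried, so that they range over a function space with finite
  -- domain and codomain, which any-fun? and all-fun? can search.
  Adjacency : Set
  Adjacency = Vertex c s × Vertex c s → Bool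

  IsSymmetric : Adjacency → Set
  IsSymmetric a = ∀ u v → a (u , v) ≡ a (v , u)

  IsMultipartite : Adjacency → Set
  IsMultipartite a = ∀ u v → a (u , v) ≡ true → KEdge u v

  subgraph : (a : Adjacency) → IsSymmetric a → IsMultipartite a → Subgraph c s
  subgraph a a-sym a-K = record { adj = λ u v → a (u , v) ; adj-sym = a-sym ; adj-K = a-K }

  ArrowsAt : ℕ → Adjacency → Set
  ArrowsAt n a = (a-sym : IsSymmetric a) (a-K : IsMultipartite a) →
                 HasC4 (subgraph a a-sym a-K) ⊎ CoHasStar (subgraph a a-sym a-K) n

  ArrowsAt-resp : ∀ {n a b} → a ≗ b → ArrowsAt n a → ArrowsAt n b
  ArrowsAt-resp {n} {a} {b} a≗b arrows b-sym b-K =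
    Sum.map (HasC4-resp {H} {H′} same) (CoHasStar-resp {H} {H′} same) (arrows a-sym a-K)
    where
    same : ∀ u v → a (u , v) ≡ b (u , v)
    same u v = a≗b (u , v)
    a-sym : IsSymmetric a
    a-sym u v = trans (same u v) (trans (b-sym u v) (sym (same v u)))
    a-K : IsMultipartite a
    a-K u v uv = b-K u v (trans (sym (same u v)) uv)
    H H′ : Subgraph c s
    H  = subgraph a a-sym a-K
    H′ = subgraph b b-sym b-K

  -- The conclusion does not depend on the two proofs, so one pair of them decides it for all.
  ArrowsAt? : ∀ n a → Dec (ArrowsAt n a)
  ArrowsAt? n a
    with all-vertex? (λ u → all-vertex? λ v → a (u , v) ≟ᵇ a (v , u))
       | all-vertex? (λ u → all-vertex? λ v → (a (u , v) ≟ᵇ true) →-dec ¬? (proj₁ u ≟ᶠ proj₁ v))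
  ... | no ¬a-sym | _       = yes λ a-sym → ⊥-elim (¬a-sym a-sym)
  ... | yes _     | no ¬a-K = yes λ _ a-K → ⊥-elim (¬a-K a-K)
  ... | yes a-sym | yes a-K = map′ (λ q _ _ → q) (λ arrows → arrows a-sym a-K)
    (HasC4? H ⊎-dec CoHasStar? H n)
    where H = subgraph a a-sym a-K

Arrows? : ∀ s n c → Dec (Arrows s n c)
Arrows? s n c = map′ (λ arrows H → arrows (λ (u , v) → adj H u v) (adj-sym H) (adj-K H))
  (λ arr a a-sym a-K → arr (subgraph a a-sym a-K))
  (all-fun? (↔-trans *↔× (*↔× ×-↔ *↔×)) 2↔Bool ArrowsAt-resp (ArrowsAt? n))

proposition2p1 : (s n : ℕ) → 2 ≤ s → 2 ≤ n →
    (m : ℕ) → IsM s n m →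
    Σ ℕ λ m′ → IsM s (suc n) m′ × m′ ≤ m + 2
proposition2p1 (suc zero) n (s≤s ()) _ m _
proposition2p1 (suc (suc s′)) n _ _ m (_ , arr , _)
  with least (λ c → (1 ≤? c) ×-dec Arrows? _ (suc n) c) {2 + m} (s≤s z≤n , Arrows-suc arr)
... | m′ , (1≤m′ , arr′) , minimal =
  m′ , (1≤m′ , arr′ , λ c 1≤c arr-c → minimal c (1≤c , arr-c)) ,
  ≤-trans (minimal (2 + m) (s≤s z≤n , Arrows-suc arr)) (≤-reflexive (+-comm 2 m))
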